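{- Let $(C_n,S)$ be an instance of cycle VCA. Every inclusion-minimal feasible set $S'\subseteq S$ is acyclic (as a graph on $[n]$) and thus has size at most $n-1$. In particular, every inclusion-minimal feasible set $S'$ satisfies $|S'|\le 2|\mathrm{OPT}|$, where $\mathrm{OPT}$ is a minimum-size feasible set.
   Context: Let $n\ge 4$ and let $C_n$ be the cycle on $[n]$ with edges $\{i,i+1\}$ and $\{n,1\}$. A chord is an edge between two non-consecutive vertices of $C_n$. An instance of cycle VCA is a pair $(C_n,S)$, $S$ a set of chords (links) with $C_n\cup S$ 3-vertex-connected; $S'\subseteq S$ is feasible if $C_n\cup S'$ is 3-vertex-connected. -}

module Defs where

open import Data.Nat using (ℕ; zero; suc; _<_; _≤_; _∸_; _*_)
open import Data.Fin using (Fin; toℕ)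
open import Data.Product using (_×_; _,_; Σ; ∃)
open import Data.Sum using (_⊎_)
open import Data.List using (List; []; _∷_; _++_; [_]; length)
open import Data.List.Membership.Propositional using (_∈_)
open import Data.List.Relation.Binary.Subset.Propositional using (_⊆_)
open import Data.List.Relation.Unary.Unique.Propositional using (Unique)
open import Data.List.Relation.Unary.Linked using (Linked)
open import Relation.Binary.PropositionalEquality using (_≡_; _≢_)
open import Relation.Nullary using (¬_)

-- Vertices of C_n are Fin n (vertex k represents k+1 ∈ [n]).
-- Edges of C_n: {k, k+1} for 0 ≤ k < n-1, and {n-1, 0}.
CycEdge : ∀ {n} → Fin n → Fin n → Set
CycEdge {n} i j =
  suc (toℕ i) ≡ toℕ j ⊎ suc (toℕ j) ≡ toℕ i
  ⊎ (toℕ i ≡ 0 × suc (toℕ j) ≡ n) ⊎ (toℕ j ≡ 0 × suc (toℕ i) ≡ n)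

-- A link is stored as an ordered pair (i , j) with i < j; it is a chord
-- iff i and j are not consecutive on C_n.
IsChord : ∀ {n} → Fin n × Fin n → Set
IsChord (i , j) = (toℕ i < toℕ j) × ¬ CycEdge i j

-- A set of links: a duplicate-free list of chords (so it represents a set
-- of unordered chords, and its length is its cardinality).
LinkSet : ℕ → Set
LinkSet n = List (Fin n × Fin n)

WellFormed : ∀ {n} → LinkSet n → Set
WellFormed {n} S = Unique S × (∀ {e} → e ∈ S → IsChord e)

LinkAdj : ∀ {n} → LinkSet n → Fin n → Fin n → Set
LinkAdj S u v = (u , v) ∈ S ⊎ (v , u) ∈ S

Adj : ∀ {n} → LinkSet n → Fin n → Fin n → Set
Adj S u v = CycEdge u v ⊎ LinkAdj S u v

data Reach {n} (S : LinkSet n) (a b : Fin n) (u : Fin n) : Fin n → Set where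
  here : Reach S a b u u
  step : ∀ {v w} → Reach S a b u v → Adj S v w → w ≢ a → w ≢ b → Reach S a b u w

ConnectedMinus : ∀ {n} → LinkSet n → Fin n → Fin n → Set
ConnectedMinus S a b =
  ∀ u v → u ≢ a → u ≢ b → v ≢ a → v ≢ b → Reach S a b u v

ThreeConnected : ∀ {n} → LinkSet n → Set
ThreeConnected {n} S = (3 < n) × (∀ a b → ConnectedMinus S a b)

Instance : ∀ {n} → LinkSet n → Set
Instance S = WellFormed S × ThreeConnected S

Feasible : ∀ {n} → LinkSet n → Set
Feasible S = ThreeConnected S

MinimalFeasible : ∀ {n} → LinkSet n → LinkSet n → Set
MinimalFeasible S S' =
  WellFormed S' × S' ⊆ S × Feasible S' ×
  (∀ (T : LinkSet _) → T ⊆ S' → Feasible T → S' ⊆ T)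

Optimum : ∀ {n} → LinkSet n → LinkSet n → Set
Optimum S O =
  WellFormed O × O ⊆ S × Feasible O ×
  (∀ (T : LinkSet _) → WellFormed T → T ⊆ S → Feasible T → length O ≤ length T)

HasCycle : ∀ {n} → LinkSet n → Set
HasCycle {n} S = Σ (Fin n) λ v → Σ (List (Fin n)) λ ws →
  (2 ≤ length ws) × Unique (v ∷ ws) × Linked (LinkAdj S) (v ∷ ws ++ [ v ])

Acyclic : ∀ {n} → LinkSet n → Set
Acyclic S = ¬ HasCycle S

{-# OPTIONS --safe #-}
module Submission where

-- For p < q not consecutive on C_n, removing p and q splits C_n into the vertices strictly
-- between them ("inside") and those outside; C_n ∪ S is 3-connected iff every such cut is
-- crossed by a link of S joining the two sides. Minimality then gives every link uw of S' a
-- private cut, crossed by no other link of S'. Suppose S' contains a cycle, and take a cycle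
-- link uv whose private cut {a , b} has u inside. The other cycle-neighbour w of u lies in
-- [a , b], and comparing {a , b} with the private cut {c , d} of uw produces a cycle link whose
-- private cut spans a strictly shorter interval, unless w is an endpoint of {a , b}; then
-- {c , d} must be the two cycle-neighbours of w, which the second cycle link at w also crosses.
-- So S' is a forest and has at most n - 1 links. Finally the two cycle-neighbours of any vertex
-- form a cut, so every vertex is an end of a link of a feasible set O, whence n ≤ 2 |O|.

open import Defs
open import Data.Nat using (ℕ; zero; suc; _+_; _≤_; _<_; _∸_; _*_; z≤n; s≤s; _<?_; _≤?_)
open import Data.Nat.Properties
open import Data.Fin using (Fin; toℕ; fromℕ<)
open import Data.Fin.Properties using (toℕ-injective; toℕ<n; toℕ-fromℕ<; any?; all?; ¬∀⟶∃¬; pigeonhole)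
import Data.Fin.Properties as Finₚ
open import Data.Product using (Σ; _×_; _,_; ∃; ∃₂; proj₁; proj₂)
open import Data.Product.Properties using (≡-dec)
open import Data.Sum using (_⊎_; inj₁; inj₂)
open import Data.Empty using (⊥; ⊥-elim)
open import Data.List using (List; []; _∷_; _++_; [_]; length; filter; lookup; allFin)
open import Data.List.Properties using (length-tabulate; ∷ʳ-injective; ++-assoc; ∷-injective)
open import Data.List.Membership.Propositional using (_∈_)
open import Data.List.Membership.Propositional.Properties using (∈-filter⁺; ∈-filter⁻; ∈-allFin; ∈-++⁺ʳ)
import Data.List.Membership.DecPropositional as DecMembership
open import Data.List.Relation.Binary.Subset.Propositional using (_⊆_)
open import Data.List.Relation.Unary.Any using (here; there; index)
open import Data.List.Relation.Unary.Any.Properties using (lookup-index)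
import Data.List.Relation.Unary.All as All
import Data.List.Relation.Unary.All.Properties as Allₚ
open import Data.List.Relation.Unary.AllPairs using ([]; _∷_)
import Data.List.Relation.Unary.AllPairs as AllPairs
open import Data.List.Relation.Unary.Linked using (Linked; [-]; _∷_)
open import Data.List.Relation.Unary.Unique.Propositional using (Unique)
import Data.List.Relation.Unary.Unique.Propositional.Properties as Uniqueₚ
open import Function using (_∘_; _⇔_; Equivalence; mk⇔)
open import Relation.Binary.Definitions using (tri<; tri≈; tri>)
open import Relation.Binary.PropositionalEquality using (_≡_; _≢_; refl; sym; trans; cong; subst; subst₂; module ≡-Reasoning)
open import Relation.Nullary using (¬_; Dec; yes; no)
open import Relation.Nullary.Decidable using (_×-dec_; _⊎-dec_; _→-dec_; ¬?)

private variable
  n : ℕ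
  S : LinkSet n
  a b c d i j k p p′ q q′ u v w x y z : Fin n
  f g : Fin n → Fin n
  ws ws₁ ws₂ xs : List (Fin n)
  R R′ : Fin n → Fin n → Set

Inside : Fin n → Fin n → Fin n → Set
Inside p q x = toℕ p < toℕ x × toℕ x < toℕ q

Outside : Fin n → Fin n → Fin n → Set
Outside p q x = toℕ x < toℕ p ⊎ toℕ q < toℕ x

Crosses : Fin n → Fin n → Fin n → Fin n → Set
Crosses p q x z = Inside p q x × Outside p q z ⊎ Outside p q x × Inside p q z

-- p < q are not consecutive on C_n, where {0 , n - 1} also counts as consecutive.
IsCut : Fin n → Fin n → Set
IsCut {n} p q = suc (toℕ p) < toℕ q × (0 < toℕ p ⊎ suc (toℕ q) < n)

CrossedBy : LinkSet n → Fin n → Fin n → Set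
CrossedBy S p q = ∃₂ λ x z → LinkAdj S x z × Crosses p q x z

CrossesAllCuts : LinkSet n → Set
CrossesAllCuts {n} S = (p q : Fin n) → IsCut p q → CrossedBy S p q

toℕ<⇒≢ : toℕ x < toℕ y → x ≢ y
toℕ<⇒≢ lt refl = <-irrefl refl lt

toℕ>⇒≢ : toℕ y < toℕ x → x ≢ y
toℕ>⇒≢ lt refl = <-irrefl refl lt

Inside⇒¬Outside : Inside p q x → ¬ Outside p q x
Inside⇒¬Outside (p<x , _) (inj₁ x<p) = <-asym p<x x<p
Inside⇒¬Outside (_ , x<q) (inj₂ q<x) = <-asym x<q q<x

Inside-Outside-≢ : Inside p q x → Outside p q y → x ≢ y
Inside-Outside-≢ ix oy refl = Inside⇒¬Outside ix oy

Inside⇒≢ˡ : Inside p q x → x ≢ p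
Inside⇒≢ˡ (p<x , _) = toℕ>⇒≢ p<x

Inside⇒≢ʳ : Inside p q x → x ≢ q
Inside⇒≢ʳ (_ , x<q) = toℕ<⇒≢ x<q

Outside⇒≢ˡ : toℕ p ≤ toℕ q → Outside p q x → x ≢ p
Outside⇒≢ˡ _   (inj₁ x<p) = toℕ<⇒≢ x<p
Outside⇒≢ˡ p≤q (inj₂ q<x) = toℕ>⇒≢ (≤-<-trans p≤q q<x)

Outside⇒≢ʳ : toℕ p ≤ toℕ q → Outside p q x → x ≢ q
Outside⇒≢ʳ p≤q (inj₁ x<p) = toℕ<⇒≢ (<-≤-trans x<p p≤q)
Outside⇒≢ʳ _   (inj₂ q<x) = toℕ>⇒≢ q<x

Inside-mono : toℕ p ≤ toℕ p′ → toℕ q′ ≤ toℕ q → Inside p′ q′ x → Inside p q x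
Inside-mono p≤p′ q′≤q (p′<x , x<q′) = ≤-<-trans p≤p′ p′<x , <-≤-trans x<q′ q′≤q

Outside-mono : toℕ p′ ≤ toℕ p → toℕ q ≤ toℕ q′ → Outside p′ q′ x → Outside p q x
Outside-mono p′≤p _ (inj₁ x<p′) = inj₁ (<-≤-trans x<p′ p′≤p)
Outside-mono _ q≤q′ (inj₂ q′<x) = inj₂ (≤-<-trans q≤q′ q′<x)

inside⊎outside : (p q x : Fin n) → x ≢ p → x ≢ q → Inside p q x ⊎ Outside p q x
inside⊎outside p q x x≢p x≢q with <-cmp (toℕ x) (toℕ p) | <-cmp (toℕ x) (toℕ q)
... | tri< x<p _ _  | _            = inj₂ (inj₁ x<p)
... | tri≈ _ x≡p _  | _            = ⊥-elim (x≢p (toℕ-injective x≡p))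
... | tri> _ _ _    | tri≈ _ x≡q _ = ⊥-elim (x≢q (toℕ-injective x≡q))
... | tri> _ _ p<x  | tri< x<q _ _ = inj₁ (p<x , x<q)
... | tri> _ _ _    | tri> _ _ q<x = inj₂ (inj₂ q<x)

Crosses-sym : Crosses p q x z → Crosses p q z x
Crosses-sym (inj₁ (ix , oz)) = inj₂ (oz , ix)
Crosses-sym (inj₂ (ox , iz)) = inj₁ (iz , ox)

CycEdge-sym : CycEdge x y → CycEdge y x
CycEdge-sym (inj₁ e)               = inj₂ (inj₁ e)
CycEdge-sym (inj₂ (inj₁ e))        = inj₁ e
CycEdge-sym (inj₂ (inj₂ (inj₁ e))) = inj₂ (inj₂ (inj₂ e))
CycEdge-sym (inj₂ (inj₂ (inj₂ e))) = inj₂ (inj₂ (inj₁ e))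

LinkAdj-sym : LinkAdj S x y → LinkAdj S y x
LinkAdj-sym (inj₁ xy) = inj₂ xy
LinkAdj-sym (inj₂ yx) = inj₁ yx

Adj-sym : Adj S x y → Adj S y x
Adj-sym (inj₁ c) = inj₁ (CycEdge-sym c)
Adj-sym (inj₂ l) = inj₂ (LinkAdj-sym l)

CycEdge⇒¬Crosses : CycEdge x y → Inside p q x → ¬ Outside p q y
CycEdge⇒¬Crosses (inj₁ x+1≡y) (p<x , _) (inj₁ y<p) = <-asym p<x (<-trans (subst (_ <_) x+1≡y (n<1+n _)) y<p)
CycEdge⇒¬Crosses (inj₁ x+1≡y) (_ , x<q) (inj₂ q<y) = <-irrefl refl (<-≤-trans q<y (subst (_≤ _) x+1≡y x<q))
CycEdge⇒¬Crosses (inj₂ (inj₁ y+1≡x)) (p<x , _) (inj₁ y<p) = <-irrefl refl (<-≤-trans p<x (subst (_≤ _) y+1≡x y<p))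
CycEdge⇒¬Crosses (inj₂ (inj₁ y+1≡x)) (_ , x<q) (inj₂ q<y) = <-asym x<q (<-trans q<y (subst (_ <_) y+1≡x (n<1+n _)))
CycEdge⇒¬Crosses (inj₂ (inj₂ (inj₁ (x≡0 , _)))) (p<x , _) _ = <-irrefl (sym x≡0) (≤-<-trans z≤n p<x)
CycEdge⇒¬Crosses {q = q} (inj₂ (inj₂ (inj₂ (_ , x+1≡n)))) (_ , x<q) _ =
  <-irrefl refl (<-≤-trans (toℕ<n q) (subst (_≤ toℕ q) x+1≡n x<q))

-- 3-connectivity is equivalent to crossing every cut

Reach-trans : Reach S a b u v → Reach S a b v w → Reach S a b u w
Reach-trans r here                 = r
Reach-trans r (step r′ e w≢a w≢b) = step (Reach-trans r r′) e w≢a w≢b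

Reach-avoids : u ≢ a → u ≢ b → Reach S a b u v → v ≢ a × v ≢ b
Reach-avoids u≢a u≢b here              = u≢a , u≢b
Reach-avoids _   _   (step _ _ v≢a v≢b) = v≢a , v≢b

Reach-sym : u ≢ a → u ≢ b → Reach S a b u v → Reach S a b v u
Reach-sym u≢a u≢b here = here
Reach-sym u≢a u≢b (step r e _ _) =
  let v≢a , v≢b = Reach-avoids u≢a u≢b r
  in  Reach-trans (step here (Adj-sym e) v≢a v≢b) (Reach-sym u≢a u≢b r)

Reach-swap : Reach S a b u v → Reach S b a u v
Reach-swap here                = here
Reach-swap (step r e w≢a w≢b) = step (Reach-swap r) e w≢b w≢a

vertex : ∀ k → k < n → Σ (Fin n) λ x → toℕ x ≡ k
vertex k k<n = fromℕ< k<n , toℕ-fromℕ< k<n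

IsCut⇒≤ : IsCut p q → toℕ p ≤ toℕ q
IsCut⇒≤ (p+1<q , _) = <⇒≤ (<-trans (n<1+n _) p+1<q)

IsCut⇒sides : IsCut p q → ∃ (Inside p q) × ∃ (Outside p q)
IsCut⇒sides {p = p} {q = q} (p+1<q , side) = inside , outside side
  where
  inside : ∃ (Inside p q)
  inside with x , x≡p+1 ← vertex _ (<-trans p+1<q (toℕ<n q)) =
    x , subst (toℕ p <_) (sym x≡p+1) ≤-refl , subst (_< toℕ q) (sym x≡p+1) p+1<q
  outside : 0 < toℕ p ⊎ suc (toℕ q) < _ → ∃ (Outside p q)
  outside (inj₁ 0<p) with x , x≡0 ← vertex 0 (<-trans 0<p (toℕ<n p)) = x , inj₁ (subst (_< toℕ p) (sym x≡0) 0<p)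
  outside (inj₂ q+1<n) with x , x≡q+1 ← vertex _ q+1<n = x , inj₂ (subst (toℕ q <_) (sym x≡q+1) ≤-refl)

sides⇒IsCut : Inside p q x → Outside p q y → IsCut p q
sides⇒IsCut (p<x , x<q) (inj₁ y<p) = <-≤-trans (s≤s p<x) x<q , inj₁ (≤-<-trans z≤n y<p)
sides⇒IsCut {y = y} (p<x , x<q) (inj₂ q<y) = <-≤-trans (s≤s p<x) x<q , inj₂ (≤-<-trans q<y (toℕ<n y))

Reach⇒CrossedBy : Reach S p q u w → Inside p q u → Outside p q w → CrossedBy S p q
Reach⇒CrossedBy here iu ow = ⊥-elim (Inside⇒¬Outside iu ow)
Reach⇒CrossedBy {p = p} {q} (step {v} r e w≢p w≢q) iu ow
  with Reach-avoids (Inside⇒≢ˡ iu) (Inside⇒≢ʳ iu) r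
... | v≢p , v≢q with inside⊎outside p q v v≢p v≢q | e
...   | inj₂ ov | _       = Reach⇒CrossedBy r iu ov
...   | inj₁ iv | inj₁ c  = ⊥-elim (CycEdge⇒¬Crosses c iv ow)
...   | inj₁ iv | inj₂ l  = _ , _ , l , inj₁ (iv , ow)

ThreeConnected⇒CrossesAllCuts : {S : LinkSet n} → ThreeConnected S → CrossesAllCuts S
ThreeConnected⇒CrossesAllCuts (_ , connected) p q cut with (x , ix) , (y , oy) ← IsCut⇒sides cut =
  Reach⇒CrossedBy (connected p q x y (Inside⇒≢ˡ ix) (Inside⇒≢ʳ ix) (Outside⇒≢ˡ p≤q oy) (Outside⇒≢ʳ p≤q oy)) ix oy
  where
  p≤q : toℕ p ≤ toℕ q
  p≤q = IsCut⇒≤ cut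

Avoids : Fin n → Fin n → Fin n → Set
Avoids a b k = k ≢ a × k ≢ b

reach-up : ∀ d → toℕ x + d ≡ toℕ y →
           (∀ k → toℕ x ≤ toℕ k → toℕ k ≤ toℕ y → Avoids a b k) → Reach S a b x y
reach-up zero x+0≡y _ = subst (Reach _ _ _ _) (toℕ-injective (trans (sym (+-identityʳ _)) x+0≡y)) here
reach-up {x = x} {y = y} (suc d) x+d+1≡y free =
  step (reach-up d (sym (toℕ-fromℕ< y⁻<n)) (λ k xk ky⁻ → free k xk (≤-trans ky⁻ y⁻≤y)))
       (inj₁ (inj₁ y⁻+1≡y)) (proj₁ (free y x≤y ≤-refl)) (proj₂ (free y x≤y ≤-refl))
  where
  x+d<y : toℕ x + d < toℕ y
  x+d<y = ≤-reflexive (trans (sym (+-suc (toℕ x) d)) x+d+1≡y)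
  y⁻<n : toℕ x + d < _
  y⁻<n = <-trans x+d<y (toℕ<n y)
  y⁻+1≡y : suc (toℕ (fromℕ< y⁻<n)) ≡ toℕ y
  y⁻+1≡y = trans (cong suc (toℕ-fromℕ< y⁻<n)) (trans (sym (+-suc (toℕ x) d)) x+d+1≡y)
  y⁻≤y : toℕ (fromℕ< y⁻<n) ≤ toℕ y
  y⁻≤y = subst (_≤ toℕ y) (sym (toℕ-fromℕ< y⁻<n)) (<⇒≤ x+d<y)
  x≤y : toℕ x ≤ toℕ y
  x≤y = subst (toℕ x ≤_) x+d+1≡y (m≤m+n _ _)

Convex : (Fin n → Set) → Set
Convex P = ∀ {x y k} → P x → P y → toℕ x ≤ toℕ k → toℕ k ≤ toℕ y → P k

reach-within : (P : Fin n → Set) → Convex P → (∀ {k} → P k → Avoids a b k) →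
               P x → P y → Reach S a b x y
reach-within {x = x} {y = y} P convex avoids px py with ≤-total (toℕ x) (toℕ y)
... | inj₁ x≤y = reach-up _ (m+[n∸m]≡n x≤y) (λ k xk ky → avoids (convex px py xk ky))
... | inj₂ y≤x = Reach-sym (proj₁ (avoids py)) (proj₂ (avoids py))
                   (reach-up _ (m+[n∸m]≡n y≤x) (λ k yk kx → avoids (convex py px yk kx)))

Inside-convex : Convex (Inside p q)
Inside-convex (px , _) (_ , yq) xk ky = <-≤-trans px xk , ≤-<-trans ky yq

Below-convex : {p : Fin n} → Convex {n} (λ x → toℕ x < toℕ p)
Below-convex _ yp _ ky = ≤-<-trans ky yp

Above-convex : {q : Fin n} → Convex {n} (λ x → toℕ q < toℕ x)
Above-convex qx _ xk _ = <-≤-trans qx xk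

lastVertex : ∀ {n} → Fin n → Σ (Fin n) λ l → suc (toℕ l) ≡ n
lastVertex {suc m} _ with l , l≡m ← vertex m ≤-refl = l , cong suc l≡m

firstVertex : Fin n → Σ (Fin n) λ f → toℕ f ≡ 0
firstVertex x = vertex 0 (≤-<-trans z≤n (toℕ<n x))

module CrossingConnectivity {n : ℕ} {S : LinkSet n} (crosses : CrossesAllCuts S)
                            {a b : Fin n} (a≤b : toℕ a ≤ toℕ b) where

  inside-reach : Inside a b x → Inside a b y → Reach S a b x y
  inside-reach = reach-within (Inside a b) Inside-convex (λ ik → Inside⇒≢ˡ ik , Inside⇒≢ʳ ik)

  below-reach : toℕ x < toℕ a → toℕ y < toℕ a → Reach S a b x y
  below-reach = reach-within _ Below-convex (λ k<a → toℕ<⇒≢ k<a , toℕ<⇒≢ (<-≤-trans k<a a≤b))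

  above-reach : toℕ b < toℕ x → toℕ b < toℕ y → Reach S a b x y
  above-reach = reach-within _ Above-convex (λ b<k → toℕ>⇒≢ (≤-<-trans a≤b b<k) , toℕ>⇒≢ b<k)

  -- around the cycle through its edge {n - 1 , 0}
  above-below-reach : toℕ b < toℕ x → toℕ y < toℕ a → Reach S a b x y
  above-below-reach {x = x} b<x y<a
    with last , last+1≡n ← lastVertex x | first , first≡0 ← firstVertex x =
    Reach-trans (Reach-trans (above-reach b<x (<-≤-trans b<x x≤last))
                             (step here wrap (toℕ<⇒≢ first<a) (toℕ<⇒≢ (<-≤-trans first<a a≤b))))
                (below-reach first<a y<a)
    where
    x≤last : toℕ x ≤ toℕ last
    x≤last = ≤-pred (subst (suc (toℕ x) ≤_) (sym last+1≡n) (toℕ<n x))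
    wrap : Adj S last first
    wrap = inj₁ (inj₂ (inj₂ (inj₂ (first≡0 , last+1≡n))))
    first<a : toℕ first < toℕ a
    first<a = subst (_< toℕ a) (sym first≡0) (≤-<-trans z≤n y<a)

  outside-reach : Outside a b x → Outside a b y → Reach S a b x y
  outside-reach (inj₁ x<a) (inj₁ y<a) = below-reach x<a y<a
  outside-reach (inj₂ b<x) (inj₂ b<y) = above-reach b<x b<y
  outside-reach (inj₂ b<x) (inj₁ y<a) = above-below-reach b<x y<a
  outside-reach (inj₁ x<a) (inj₂ b<y) =
    Reach-sym (toℕ>⇒≢ (≤-<-trans a≤b b<y)) (toℕ>⇒≢ b<y) (above-below-reach b<y x<a)

  inside-outside-reach : Inside a b x → Outside a b y → Reach S a b x y
  inside-outside-reach ix oy with crosses a b (sides⇒IsCut ix oy)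
  ... | _ , _ , l , inj₁ (ix′ , oz′) =
    Reach-trans (step (inside-reach ix ix′) (inj₂ l) (Outside⇒≢ˡ a≤b oz′) (Outside⇒≢ʳ a≤b oz′))
                (outside-reach oz′ oy)
  ... | _ , _ , l , inj₂ (ox′ , iz′) =
    Reach-trans (step (inside-reach ix iz′) (inj₂ (LinkAdj-sym l)) (Outside⇒≢ˡ a≤b ox′) (Outside⇒≢ʳ a≤b ox′))
                (outside-reach ox′ oy)

  connected : ConnectedMinus S a b
  connected x y x≢a x≢b y≢a y≢b with inside⊎outside a b x x≢a x≢b | inside⊎outside a b y y≢a y≢b
  ... | inj₁ ix | inj₁ iy = inside-reach ix iy
  ... | inj₁ ix | inj₂ oy = inside-outside-reach ix oy
  ... | inj₂ ox | inj₁ iy = Reach-sym y≢a y≢b (inside-outside-reach iy ox)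
  ... | inj₂ ox | inj₂ oy = outside-reach ox oy

CrossesAllCuts⇒ThreeConnected : {S : LinkSet n} → 3 < n → CrossesAllCuts S → ThreeConnected S
CrossesAllCuts⇒ThreeConnected 3<n crosses = 3<n , connected
  where
  connected : ∀ a b → ConnectedMinus _ a b
  connected a b with ≤-total (toℕ a) (toℕ b)
  ... | inj₁ a≤b = CrossingConnectivity.connected crosses a≤b
  ... | inj₂ b≤a = λ x y x≢a x≢b y≢a y≢b →
    Reach-swap (CrossingConnectivity.connected crosses b≤a x y x≢b x≢a y≢b y≢a)

-- Private cuts of the links of a minimal feasible set

SamePair : Fin n → Fin n → Fin n → Fin n → Set
SamePair x z u w = x ≡ u × z ≡ w ⊎ x ≡ w × z ≡ u

CrossedOnlyBy : LinkSet n → Fin n → Fin n → Fin n → Fin n → Set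
CrossedOnlyBy {n} S p q u w = (x z : Fin n) → LinkAdj S x z → Crosses p q x z → SamePair x z u w

PrivateCut : LinkSet n → Fin n → Fin n → Set
PrivateCut S u w = ∃₂ λ p q → IsCut p q × Crosses p q u w × CrossedOnlyBy S p q u w

SamePair-swapˡ : SamePair x z u w → SamePair z x u w
SamePair-swapˡ (inj₁ (x≡u , z≡w)) = inj₂ (z≡w , x≡u)
SamePair-swapˡ (inj₂ (x≡w , z≡u)) = inj₁ (z≡u , x≡w)

SamePair-swapʳ : SamePair x z u w → SamePair x z w u
SamePair-swapʳ (inj₁ eqs) = inj₂ eqs
SamePair-swapʳ (inj₂ eqs) = inj₁ eqs

SamePair-swap : SamePair z x u w → SamePair x z w u
SamePair-swap = SamePair-swapʳ ∘ SamePair-swapˡ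

SamePair⇒≡ˡ : SamePair x z u w → x ≢ u → x ≢ w → ⊥
SamePair⇒≡ˡ (inj₁ (x≡u , _)) x≢u _ = x≢u x≡u
SamePair⇒≡ˡ (inj₂ (x≡w , _)) _ x≢w = x≢w x≡w

CrossedOnlyBy-swap : CrossedOnlyBy S p q u w → CrossedOnlyBy S p q w u
CrossedOnlyBy-swap only x z l c = SamePair-swapʳ (only x z l c)

CrossedOnlyBy-intro : (∀ x z → LinkAdj S x z → Inside p q x → Outside p q z → SamePair x z u w) →
                      CrossedOnlyBy S p q u w
CrossedOnlyBy-intro only x z l (inj₁ (ix , oz)) = only x z l ix oz
CrossedOnlyBy-intro only x z l (inj₂ (ox , iz)) = SamePair-swapˡ (only z x (LinkAdj-sym l) iz ox)

Inside? : (p q x : Fin n) → Dec (Inside p q x)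
Inside? p q x = (toℕ p <? toℕ x) ×-dec (toℕ x <? toℕ q)

Outside? : (p q x : Fin n) → Dec (Outside p q x)
Outside? p q x = (toℕ x <? toℕ p) ⊎-dec (toℕ q <? toℕ x)

Crosses? : (p q x z : Fin n) → Dec (Crosses p q x z)
Crosses? p q x z = (Inside? p q x ×-dec Outside? p q z) ⊎-dec (Outside? p q x ×-dec Inside? p q z)

IsCut? : (p q : Fin n) → Dec (IsCut p q)
IsCut? {n} p q = (suc (toℕ p) <? toℕ q) ×-dec ((0 <? toℕ p) ⊎-dec (suc (toℕ q) <? n))

_≟ₗ_ : (e f : Fin n × Fin n) → Dec (e ≡ f)
_≟ₗ_ = ≡-dec Finₚ._≟_ Finₚ._≟_

LinkAdj? : (S : LinkSet n) (x z : Fin n) → Dec (LinkAdj S x z)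
LinkAdj? S x z = DecMembership._∈?_ _≟ₗ_ (x , z) S ⊎-dec DecMembership._∈?_ _≟ₗ_ (z , x) S

CrossedBy? : (S : LinkSet n) (p q : Fin n) → Dec (CrossedBy S p q)
CrossedBy? S p q = any? λ x → any? λ z → LinkAdj? S x z ×-dec Crosses? p q x z

¬CrossesAllCuts⇒uncrossedCut : {S : LinkSet n} → ¬ CrossesAllCuts S → ∃₂ λ p q → IsCut p q × ¬ CrossedBy S p q
¬CrossesAllCuts⇒uncrossedCut {n} {S} ¬crosses
  with p , ¬crossesAt-p ← ¬∀⟶∃¬ n _ (λ p → all? λ q → IsCut? p q →-dec CrossedBy? S p q) ¬crosses
  with q , ¬crossesAt-pq ← ¬∀⟶∃¬ n _ (λ q → IsCut? p q →-dec CrossedBy? S p q) ¬crossesAt-p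
  with IsCut? p q
... | yes cut = p , q , cut , λ crossed → ¬crossesAt-pq λ _ → crossed
... | no ¬cut = ⊥-elim (¬crossesAt-pq λ cut → ⊥-elim (¬cut cut))

-- By minimality S without uw is infeasible, so some cut is crossed by no other link of S.
privateCut : {S : LinkSet n} {u w : Fin n} → 3 < n → Feasible S → (∀ T → T ⊆ S → Feasible T → S ⊆ T) →
             (u , w) ∈ S → PrivateCut S u w
privateCut {S = S} {u = u} {w = w} 3<n feasible minimal uw∈S = private-of (¬CrossesAllCuts⇒uncrossedCut ¬crossesAll)
  where
  ≢uw : (e : Fin _ × Fin _) → Dec (e ≢ (u , w))
  ≢uw e = ¬? (e ≟ₗ (u , w))
  T : LinkSet _
  T = filter ≢uw S
  ¬crossesAll : ¬ CrossesAllCuts T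
  ¬crossesAll crosses =
    proj₂ (∈-filter⁻ ≢uw {xs = S} (minimal T (proj₁ ∘ ∈-filter⁻ ≢uw {xs = S}) (CrossesAllCuts⇒ThreeConnected 3<n crosses) uw∈S)) refl
  private-of : (∃₂ λ p q → IsCut p q × ¬ CrossedBy T p q) → PrivateCut S u w
  private-of (p , q , cut , ¬crossed) = p , q , cut , crosses-uw , only-uw
    where
    only-uw : CrossedOnlyBy S p q u w
    only-uw x z (inj₁ xz∈S) c with (x , z) ≟ₗ (u , w)
    ... | yes refl = inj₁ (refl , refl)
    ... | no xz≢uw = ⊥-elim (¬crossed (x , z , inj₁ (∈-filter⁺ ≢uw xz∈S xz≢uw) , c))
    only-uw x z (inj₂ zx∈S) c with (z , x) ≟ₗ (u , w)
    ... | yes refl = inj₂ (refl , refl)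
    ... | no zx≢uw = ⊥-elim (¬crossed (x , z , inj₂ (∈-filter⁺ ≢uw zx∈S zx≢uw) , c))
    crosses-uw : Crosses p q u w
    crosses-uw with x , z , l , c ← ThreeConnected⇒CrossesAllCuts feasible p q cut with only-uw x z l c
    ... | inj₁ (refl , refl) = c
    ... | inj₂ (refl , refl) = Crosses-sym c

PrivateCut-sym : PrivateCut S u w → PrivateCut S w u
PrivateCut-sym (p , q , cut , c , only) = p , q , cut , Crosses-sym c , CrossedOnlyBy-swap only

Isolates : Fin n → Fin n → Fin n → Set
Isolates c d w = (∀ y → Inside c d y → y ≡ w) × Inside c d w ⊎ (∀ y → Outside c d y → y ≡ w) × Outside c d w

NeighbourCut : Fin n → Fin n → Fin n → Set
NeighbourCut c d w = CycEdge w c × CycEdge w d × Isolates c d w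

NeighbourCut⇒Crosses : NeighbourCut c d w → y ≢ w → ¬ CycEdge w y → Crosses c d w y
NeighbourCut⇒Crosses {c = c} {d} {y = y} (wc , wd , isolates) y≢w ¬wy
  with inside⊎outside c d y (λ { refl → ¬wy wc }) (λ { refl → ¬wy wd }) | isolates
... | inj₁ iy | inj₁ (only , _)  = ⊥-elim (y≢w (only y iy))
... | inj₁ iy | inj₂ (_ , ow)    = inj₂ (ow , iy)
... | inj₂ oy | inj₁ (_ , iw)    = inj₁ (iw , oy)
... | inj₂ oy | inj₂ (only , _)  = ⊥-elim (y≢w (only y oy))

NeighbourCut⇒incident : NeighbourCut c d w → CrossedBy S c d → ∃ λ y → LinkAdj S w y
NeighbourCut⇒incident (_ , _ , inj₁ (only , _)) (x , z , l , inj₁ (ix , _)) = z , subst (λ k → LinkAdj _ k z) (only x ix) l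
NeighbourCut⇒incident (_ , _ , inj₁ (only , _)) (x , z , l , inj₂ (_ , iz)) = x , subst (λ k → LinkAdj _ k x) (only z iz) (LinkAdj-sym l)
NeighbourCut⇒incident (_ , _ , inj₂ (only , _)) (x , z , l , inj₁ (_ , oz)) = x , subst (λ k → LinkAdj _ k x) (only z oz) (LinkAdj-sym l)
NeighbourCut⇒incident (_ , _ , inj₂ (only , _)) (x , z , l , inj₂ (ox , _)) = z , subst (λ k → LinkAdj _ k z) (only x ox) l

middleCut : suc (toℕ c) ≡ toℕ w → suc (toℕ w) ≡ toℕ d → NeighbourCut c d w
middleCut {d = d} c+1≡w w+1≡d =
  inj₂ (inj₁ c+1≡w) , inj₁ w+1≡d , inj₁ (only , ≤-reflexive c+1≡w , ≤-reflexive w+1≡d)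
  where
  only : ∀ y → Inside _ d y → y ≡ _
  only y (cy , yd) = toℕ-injective (≤-antisym (≤-pred (subst (suc (toℕ y) ≤_) (sym w+1≡d) yd))
                                              (subst (_≤ toℕ y) c+1≡w cy))

firstCut : ∀ {n} {c d w : Fin n} → toℕ w ≡ 0 → toℕ c ≡ 1 → suc (toℕ d) ≡ n → NeighbourCut c d w
firstCut {w = w} w≡0 c≡1 d+1≡n =
  inj₁ (trans (cong suc w≡0) (sym c≡1)) , inj₂ (inj₂ (inj₁ (w≡0 , d+1≡n))) ,
  inj₂ (only , inj₁ (subst₂ _<_ (sym w≡0) (sym c≡1) (s≤s z≤n)))
  where
  only : ∀ y → Outside _ _ y → y ≡ w
  only y (inj₁ y<c) = toℕ-injective (trans (n<1⇒n≡0 (subst (toℕ y <_) c≡1 y<c)) (sym w≡0))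
  only y (inj₂ d<y) = ⊥-elim (<-irrefl d+1≡n (<-≤-trans (s≤s d<y) (toℕ<n y)))

lastCut : ∀ {n} {c d w : Fin n} → suc (toℕ w) ≡ n → toℕ c ≡ 0 → suc (toℕ d) ≡ toℕ w → NeighbourCut c d w
lastCut {w = w} w+1≡n c≡0 d+1≡w =
  inj₂ (inj₂ (inj₂ (c≡0 , w+1≡n))) , inj₂ (inj₁ d+1≡w) , inj₂ (only , inj₂ (≤-reflexive d+1≡w))
  where
  only : ∀ y → Outside _ _ y → y ≡ w
  only y (inj₁ y<c) = ⊥-elim (n≮0 (subst (toℕ y <_) c≡0 y<c))
  only y (inj₂ d<y) = toℕ-injective (≤-antisym (≤-pred (subst (suc (toℕ y) ≤_) (sym w+1≡n) (toℕ<n y)))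
                                              (subst (_≤ toℕ y) d+1≡w d<y))

IsCut-intro : ∀ {n} {c d : Fin n} {i j} → toℕ c ≡ i → toℕ d ≡ j → suc i < j → (0 < i ⊎ suc j < n) → IsCut c d
IsCut-intro refl refl = _,_

neighbourCut-exists : ∀ {n} → 3 < n → (w : Fin n) → ∃₂ λ c d → IsCut c d × NeighbourCut c d w
neighbourCut-exists {suc (suc (suc (suc m)))} (s≤s (s≤s (s≤s (s≤s _)))) w = cutAt (toℕ w) refl
  where
  w<n : toℕ w < 4 + m
  w<n = toℕ<n w
  cutAt : ∀ k → toℕ w ≡ k → ∃₂ λ c d → IsCut c d × NeighbourCut c d w
  cutAt zero w≡0
    with c , c≡1 ← vertex 1 (s≤s (s≤s z≤n)) | d , d≡3+m ← vertex (3 + m) ≤-refl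
    = c , d , IsCut-intro c≡1 d≡3+m (s≤s (s≤s (s≤s z≤n))) (inj₁ (s≤s z≤n)) ,
      firstCut w≡0 c≡1 (cong suc d≡3+m)
  cutAt (suc k) w≡k+1 with suc (suc k) <? 4 + m
  ... | yes k+2<n
    with c , c≡k ← vertex k (<-trans (n<1+n k) (<-trans (n<1+n (suc k)) k+2<n))
       | d , d≡k+2 ← vertex (suc (suc k)) k+2<n
    = c , d , IsCut-intro c≡k d≡k+2 ≤-refl (side k) ,
      middleCut (trans (cong suc c≡k) (sym w≡k+1)) (trans (cong suc w≡k+1) (sym d≡k+2))
    where
    side : ∀ k → 0 < k ⊎ 3 + k < 4 + m
    side zero    = inj₂ (s≤s (s≤s (s≤s (s≤s z≤n))))
    side (suc _) = inj₁ (s≤s z≤n)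
  ... | no k+2≮n
    with c , c≡0 ← vertex 0 (s≤s z≤n) | d , d≡k ← vertex k (<-trans (n<1+n k) (subst (_< _) w≡k+1 w<n))
    = c , d , IsCut-intro c≡0 d≡k 1<k (inj₂ (subst (_< _) w≡k+1 w<n)) ,
      lastCut (trans (cong suc w≡k+1) k+2≡n) c≡0 (trans (cong suc d≡k) (sym w≡k+1))
    where
    k+2≡n : suc (suc k) ≡ 4 + m
    k+2≡n = ≤-antisym (subst (_< _) w≡k+1 w<n) (≮⇒≥ k+2≮n)
    1<k : 1 < k
    1<k = ≤-pred (≤-pred (subst (4 ≤_) (sym k+2≡n) (s≤s (s≤s (s≤s (s≤s z≤n))))))

-- A feasible set has at least n / 2 links

endpoints : LinkSet n → List (Fin n)
endpoints []            = []
endpoints ((x , z) ∷ S) = x ∷ z ∷ endpoints S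

length-endpoints : (S : LinkSet n) → length (endpoints S) ≡ 2 * length S
length-endpoints []      = refl
length-endpoints (_ ∷ S) = trans (cong (2 +_) (length-endpoints S)) (sym (*-suc 2 (length S)))

LinkAdj⇒∈endpoints : LinkAdj S x y → x ∈ endpoints S
LinkAdj⇒∈endpoints (inj₁ (here refl))   = here refl
LinkAdj⇒∈endpoints (inj₁ (there xy∈S))  = there (there (LinkAdj⇒∈endpoints (inj₁ xy∈S)))
LinkAdj⇒∈endpoints (inj₂ (here refl))   = there (here refl)
LinkAdj⇒∈endpoints (inj₂ (there yx∈S))  = there (there (LinkAdj⇒∈endpoints (inj₂ yx∈S)))

-- Pigeonhole: positions in xs of the vertices of Fin n must be pairwise distinct.
length-≥-exhaustive : ∀ {n} (xs : List (Fin n)) → (∀ x → x ∈ xs) → n ≤ length xs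
length-≥-exhaustive xs ∈xs = ≮⇒≥ λ xs<n →
  let i , j , i<j , same-position = pigeonhole xs<n (λ x → index (∈xs x))
  in  toℕ<⇒≢ i<j (trans (lookup-index (∈xs i))
                   (trans (cong (lookup xs) same-position) (sym (lookup-index (∈xs j)))))

n≤2*length : {S : LinkSet n} → 3 < n → CrossesAllCuts S → n ≤ 2 * length S
n≤2*length {S = S} 3<n crosses = subst (_ ≤_) (length-endpoints S) (length-≥-exhaustive (endpoints S) incident)
  where
  incident : ∀ w → w ∈ endpoints S
  incident w with c , d , cut , nc ← neighbourCut-exists 3<n w =
    LinkAdj⇒∈endpoints (proj₂ (NeighbourCut⇒incident nc (crosses c d cut)))

-- A minimal feasible set contains no subgraph of minimum degree two

module Descent {n : ℕ} {S : LinkSet n} (crosses : CrossesAllCuts S)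
  (privateCut : ∀ {u w} → LinkAdj S u w → PrivateCut S u w)
  (chord : ∀ {u w} → LinkAdj S u w → u ≢ w × ¬ CycEdge u w)
  (Z : Fin n → Fin n → Set) (Z-sym : ∀ {u w} → Z u w → Z w u)
  (Z⇒LinkAdj : ∀ {u w} → Z u w → LinkAdj S u w)
  (Z-branch : ∀ {u v} → Z u v → ∃ λ w → Z u w × w ≢ v) where

  Uncrossed : Fin n → Fin n → Set
  Uncrossed p q = ∀ x z → LinkAdj S x z → Inside p q x → Outside p q z → ⊥

  Uncrossed⇒¬IsCut : ∀ {p q} → Uncrossed p q → ¬ IsCut p q
  Uncrossed⇒¬IsCut {p} {q} uncrossed cut with crosses p q cut
  ... | x , z , l , inj₁ (ix , oz) = uncrossed x z l ix oz
  ... | x , z , l , inj₂ (ox , iz) = uncrossed z x (LinkAdj-sym l) iz ox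

  Uncrossed⇒adjacent : ∀ {p q} → toℕ p < toℕ q → 0 < toℕ p ⊎ suc (toℕ q) < n → Uncrossed p q →
                       suc (toℕ p) ≡ toℕ q
  Uncrossed⇒adjacent p<q side uncrossed =
    ≤-antisym p<q (≮⇒≥ λ p+1<q → Uncrossed⇒¬IsCut uncrossed (p+1<q , side))

  Uncrossed⇒extremal : ∀ {p q} → suc (toℕ p) < toℕ q → Uncrossed p q → toℕ p ≡ 0 × suc (toℕ q) ≡ n
  Uncrossed⇒extremal {p} {q} p+1<q uncrossed =
    n≤0⇒n≡0 (≮⇒≥ (¬cut ∘ inj₁)) , ≤-antisym (toℕ<n q) (≮⇒≥ (¬cut ∘ inj₂))
    where
    ¬cut : ¬ (0 < toℕ p ⊎ suc (toℕ q) < n)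
    ¬cut side = Uncrossed⇒¬IsCut uncrossed (p+1<q , side)

  CrossedOnlyBy⇒Uncrossed : ∀ {p q w u} → CrossedOnlyBy S p q w u → ¬ Inside p q w → Outside p q u → Uncrossed p q
  CrossedOnlyBy⇒Uncrossed only ¬iw ou x z l ix oz =
    SamePair⇒≡ˡ (only x z l (inj₁ (ix , oz))) (λ { refl → ¬iw ix }) (Inside-Outside-≢ ix ou)

  neighbourCut-contradiction : ∀ {w u c d} → Z w u → CrossedOnlyBy S c d u w → NeighbourCut c d w → ⊥
  neighbourCut-contradiction zwu only-uw nc with y , zwy , y≢u ← Z-branch zwu
    with w≢y , ¬wy ← chord (Z⇒LinkAdj zwy)
    with only-uw _ y (Z⇒LinkAdj zwy) (NeighbourCut⇒Crosses nc (w≢y ∘ sym) ¬wy)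
  ... | inj₁ (_ , y≡w) = w≢y (sym y≡w)
  ... | inj₂ (_ , y≡u) = y≢u y≡u

  NarrowerThan : Fin n → Fin n → Fin n → Fin n → Set
  NarrowerThan a′ b′ a b = toℕ a ≤ toℕ a′ × toℕ b′ ≤ toℕ b × (toℕ a < toℕ a′ ⊎ toℕ b′ < toℕ b)

  Witness : Fin n → Fin n → Fin n → Fin n → Set
  Witness a b u v = Inside a b u × Outside a b v × Z u v × CrossedOnlyBy S a b u v

  -- One descent step: w is the second Z-neighbour of u and {c , d} a private cut of uw.
  module Step {a b u v w c d : Fin n}
    (narrower : ∀ {a′ b′ u′ v′} → NarrowerThan a′ b′ a b → ¬ Witness a′ b′ u′ v′)
    (iu : Inside a b u) (ov : Outside a b v) (only-uv : CrossedOnlyBy S a b u v)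
    (zuw : Z u w) (w≢v : w ≢ v) (w≢u : w ≢ u) (a≤w : toℕ a ≤ toℕ w) (w≤b : toℕ w ≤ toℕ b)
    (only-uw : CrossedOnlyBy S c d u w) where

    a<u : toℕ a < toℕ u
    a<u = proj₁ iu
    u<b : toℕ u < toℕ b
    u<b = proj₂ iu

    crosses-ab⇒uv : ∀ {x z} → LinkAdj S x z → Inside a b x → Outside a b z → x ≡ u × z ≡ v
    crosses-ab⇒uv l ix oz with only-uv _ _ l (inj₁ (ix , oz))
    ... | inj₁ uv = uv
    ... | inj₂ (x≡v , _) = ⊥-elim (Inside-Outside-≢ ix ov x≡v)

    ¬crosses-ab : ∀ {x z} → LinkAdj S x z → Inside a b x → Outside a b z → x ≢ u → ⊥
    ¬crosses-ab l ix oz x≢u = x≢u (proj₁ (crosses-ab⇒uv l ix oz))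

    ¬crosses-cd : ∀ {x z} → LinkAdj S x z → Inside c d x → Outside c d z → x ≢ u → x ≢ w → ⊥
    ¬crosses-cd l ix oz = SamePair⇒≡ˡ (only-uw _ _ l (inj₁ (ix , oz)))

    ¬uv-crosses-cd : LinkAdj S u v → Inside c d u → Outside c d v → ⊥
    ¬uv-crosses-cd l iu′ ov′ with only-uw u v l (inj₁ (iu′ , ov′))
    ... | inj₁ (_ , v≡w) = w≢v (sym v≡w)
    ... | inj₂ (u≡w , _) = w≢u (sym u≡w)

    w≡a : ¬ toℕ a < toℕ w → toℕ w ≡ toℕ a
    w≡a a≮w = ≤-antisym (≮⇒≥ a≮w) a≤w

    w≡b : ¬ toℕ w < toℕ b → toℕ w ≡ toℕ b
    w≡b w≮b = ≤-antisym w≤b (≮⇒≥ w≮b)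

    module W<C<U<D (c<u : toℕ c < toℕ u) (u<d : toℕ u < toℕ d) (w<c : toℕ w < toℕ c) where
      a<c : toℕ a < toℕ c
      a<c = ≤-<-trans a≤w w<c
      c<b : toℕ c < toℕ b
      c<b = <-trans c<u u<b

      only-wu-across-ac : toℕ b < toℕ d → CrossedOnlyBy S a c w u
      only-wu-across-ac b<d = CrossedOnlyBy-intro only
        where
        only : ∀ x z → LinkAdj S x z → Inside a c x → Outside a c z → SamePair x z w u
        only x z l ix@(_ , x<c) (inj₁ z<a) =
          ⊥-elim (¬crosses-ab l (Inside-mono ≤-refl (<⇒≤ c<b) ix) (inj₁ z<a) (toℕ<⇒≢ (<-trans x<c c<u)))
        only x z l ix@(_ , x<c) (inj₂ c<z) with toℕ z ≤? toℕ b
        ... | yes z≤b = SamePair-swap (only-uw z x (LinkAdj-sym l) (inj₁ ((c<z , ≤-<-trans z≤b b<d) , inj₁ x<c)))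
        ... | no z≰b  =
          ⊥-elim (¬crosses-ab l (Inside-mono ≤-refl (<⇒≤ c<b) ix) (inj₂ (≰⇒> z≰b)) (toℕ<⇒≢ (<-trans x<c c<u)))

      boundary : toℕ b < toℕ d → toℕ w ≡ toℕ a → NeighbourCut c d w
      boundary b<d w≡a = firstCut (trans w≡a a≡0) (trans (sym a+1≡c) (cong suc a≡0)) d+1≡n
        where
        a+1≡c : suc (toℕ a) ≡ toℕ c
        a+1≡c = Uncrossed⇒adjacent a<c (inj₂ (≤-<-trans c<u (toℕ<n u)))
                  (CrossedOnlyBy⇒Uncrossed (only-wu-across-ac b<d) (λ (a<w , _) → <-irrefl (sym w≡a) a<w) (inj₂ c<u))
        ad-uncrossed : Uncrossed a d
        ad-uncrossed x z l (a<x , x<d) oz with toℕ x <? toℕ b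
        ... | yes x<b with refl , refl ← crosses-ab⇒uv l (a<x , x<b) (Outside-mono ≤-refl (<⇒≤ b<d) oz) =
          ¬uv-crosses-cd l (c<u , u<d) (Outside-mono (<⇒≤ a<c) ≤-refl oz)
        ... | no x≮b = ¬crosses-cd l (<-≤-trans c<b (≮⇒≥ x≮b) , x<d) (Outside-mono (<⇒≤ a<c) ≤-refl oz)
                         (toℕ>⇒≢ (<-≤-trans u<b (≮⇒≥ x≮b))) (toℕ>⇒≢ (subst (_< toℕ x) (sym w≡a) a<x))
        extremal : toℕ a ≡ 0 × suc (toℕ d) ≡ n
        extremal = Uncrossed⇒extremal (subst (_< toℕ d) (sym a+1≡c) (<-trans c<u u<d)) ad-uncrossed
        a≡0 : toℕ a ≡ 0
        a≡0 = proj₁ extremal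
        d+1≡n : suc (toℕ d) ≡ n
        d+1≡n = proj₂ extremal

      impossible : ⊥
      impossible with toℕ d ≤? toℕ b
      ... | yes d≤b = narrower (<⇒≤ a<c , d≤b , inj₁ a<c) ((c<u , u<d) , inj₁ w<c , zuw , only-uw)
      ... | no d≰b with toℕ a <? toℕ w
      ...   | yes a<w = narrower (≤-refl , <⇒≤ c<b , inj₂ c<b)
                          ((a<w , w<c) , inj₂ c<u , Z-sym zuw , only-wu-across-ac (≰⇒> d≰b))
      ...   | no a≮w  = neighbourCut-contradiction (Z-sym zuw) only-uw (boundary (≰⇒> d≰b) (w≡a a≮w))

    module C<U<D<W (c<u : toℕ c < toℕ u) (u<d : toℕ u < toℕ d) (d<w : toℕ d < toℕ w) where
      a<d : toℕ a < toℕ d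
      a<d = <-trans a<u u<d
      d<b : toℕ d < toℕ b
      d<b = <-≤-trans d<w w≤b

      only-wu-across-db : toℕ c < toℕ a → CrossedOnlyBy S d b w u
      only-wu-across-db c<a = CrossedOnlyBy-intro only
        where
        only : ∀ x z → LinkAdj S x z → Inside d b x → Outside d b z → SamePair x z w u
        only x z l ix@(d<x , _) (inj₁ z<d) with toℕ z <? toℕ a
        ... | yes z<a =
          ⊥-elim (¬crosses-ab l (Inside-mono (<⇒≤ a<d) ≤-refl ix) (inj₁ z<a) (toℕ>⇒≢ (<-trans u<d d<x)))
        ... | no z≮a = SamePair-swap (only-uw z x (LinkAdj-sym l) (inj₁ ((<-≤-trans c<a (≮⇒≥ z≮a) , z<d) , inj₂ d<x)))
        only x z l ix@(d<x , _) (inj₂ b<z) =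
          ⊥-elim (¬crosses-ab l (Inside-mono (<⇒≤ a<d) ≤-refl ix) (inj₂ b<z) (toℕ>⇒≢ (<-trans u<d d<x)))

      boundary : toℕ c < toℕ a → toℕ w ≡ toℕ b → NeighbourCut c d w
      boundary c<a w≡b = lastCut (trans (cong suc w≡b) b+1≡n) c≡0 (trans d+1≡b (sym w≡b))
        where
        d+1≡b : suc (toℕ d) ≡ toℕ b
        d+1≡b = Uncrossed⇒adjacent d<b (inj₁ (≤-<-trans z≤n u<d))
                  (CrossedOnlyBy⇒Uncrossed (only-wu-across-db c<a) (λ (_ , w<b) → <-irrefl w≡b w<b) (inj₁ u<d))
        cb-uncrossed : Uncrossed c b
        cb-uncrossed x z l (c<x , x<b) oz with toℕ a <? toℕ x
        ... | yes a<x with refl , refl ← crosses-ab⇒uv l (a<x , x<b) (Outside-mono (<⇒≤ c<a) ≤-refl oz) =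
          ¬uv-crosses-cd l (c<u , u<d) (Outside-mono ≤-refl (<⇒≤ d<b) oz)
        ... | no a≮x = ¬crosses-cd l (c<x , ≤-<-trans (≮⇒≥ a≮x) a<d) (Outside-mono ≤-refl (<⇒≤ d<b) oz)
                         (toℕ<⇒≢ (≤-<-trans (≮⇒≥ a≮x) a<u)) (toℕ<⇒≢ (subst (toℕ x <_) (sym w≡b) x<b))
        extremal : toℕ c ≡ 0 × suc (toℕ b) ≡ n
        extremal = Uncrossed⇒extremal (≤-<-trans c<u u<b) cb-uncrossed
        c≡0 : toℕ c ≡ 0
        c≡0 = proj₁ extremal
        b+1≡n : suc (toℕ b) ≡ n
        b+1≡n = proj₂ extremal

      impossible : ⊥
      impossible with toℕ a ≤? toℕ c
      ... | yes a≤c = narrower (a≤c , <⇒≤ d<b , inj₂ d<b) ((c<u , u<d) , inj₂ d<w , zuw , only-uw)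
      ... | no a≰c with toℕ w <? toℕ b
      ...   | yes w<b = narrower (<⇒≤ a<d , ≤-refl , inj₁ a<d)
                          ((d<w , w<b) , inj₁ u<d , Z-sym zuw , only-wu-across-db (≰⇒> a≰c))
      ...   | no w≮b  = neighbourCut-contradiction (Z-sym zuw) only-uw (boundary (≰⇒> a≰c) (w≡b w≮b))

    module U<C<W<D (u<c : toℕ u < toℕ c) (c<w : toℕ c < toℕ w) (w<d : toℕ w < toℕ d) where
      a<c : toℕ a < toℕ c
      a<c = <-trans a<u u<c
      c<b : toℕ c < toℕ b
      c<b = <-≤-trans c<w w≤b

      only-wu-across-cb : toℕ b < toℕ d → CrossedOnlyBy S c b w u
      only-wu-across-cb b<d = CrossedOnlyBy-intro only
        where
        only : ∀ x z → LinkAdj S x z → Inside c b x → Outside c b z → SamePair x z w u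
        only x z l (c<x , x<b) (inj₁ z<c) = SamePair-swapʳ (only-uw x z l (inj₁ ((c<x , <-trans x<b b<d) , inj₁ z<c)))
        only x z l ix@(c<x , _) (inj₂ b<z) =
          ⊥-elim (¬crosses-ab l (Inside-mono (<⇒≤ a<c) ≤-refl ix) (inj₂ b<z) (toℕ>⇒≢ (<-trans u<c c<x)))

      boundary : toℕ b < toℕ d → toℕ w ≡ toℕ b → NeighbourCut c d w
      boundary b<d w≡b = middleCut (trans c+1≡b (sym w≡b)) (trans (cong suc w≡b) b+1≡d)
        where
        c+1≡b : suc (toℕ c) ≡ toℕ b
        c+1≡b = Uncrossed⇒adjacent c<b (inj₁ (≤-<-trans z≤n u<c))
                  (CrossedOnlyBy⇒Uncrossed (only-wu-across-cb b<d) (λ (_ , w<b) → <-irrefl w≡b w<b) (inj₁ u<c))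
        ¬crosses-cd-beyond-b : ∀ {x z} → LinkAdj S x z → toℕ b < toℕ x → toℕ x < toℕ d → Outside c d z → ⊥
        ¬crosses-cd-beyond-b l b<x x<d oz = ¬crosses-cd l (<-trans c<b b<x , x<d) oz
          (toℕ>⇒≢ (<-trans u<b b<x)) (toℕ>⇒≢ (subst (_< _) (sym w≡b) b<x))
        bd-uncrossed : Uncrossed b d
        bd-uncrossed x z l (b<x , x<d) (inj₁ z<b) with z Finₚ.≟ c
        ... | yes refl = ¬crosses-ab (LinkAdj-sym l) (a<c , c<b) (inj₂ b<x) (toℕ>⇒≢ u<c)
        ... | no z≢c   = ¬crosses-cd-beyond-b l b<x x<d
                           (inj₁ (≤∧≢⇒< (≤-pred (subst (toℕ z <_) (sym c+1≡b) z<b)) (z≢c ∘ toℕ-injective)))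
        bd-uncrossed x z l (b<x , x<d) (inj₂ d<z) = ¬crosses-cd-beyond-b l b<x x<d (inj₂ d<z)
        b+1≡d : suc (toℕ b) ≡ toℕ d
        b+1≡d = Uncrossed⇒adjacent b<d (inj₁ (≤-<-trans z≤n u<b)) bd-uncrossed

      impossible : ⊥
      impossible with toℕ d ≤? toℕ b
      ... | yes d≤b = narrower (<⇒≤ a<c , d≤b , inj₁ a<c)
                        ((c<w , w<d) , inj₁ u<c , Z-sym zuw , CrossedOnlyBy-swap only-uw)
      ... | no d≰b with toℕ w <? toℕ b
      ...   | yes w<b = narrower (<⇒≤ a<c , ≤-refl , inj₁ a<c)
                          ((c<w , w<b) , inj₁ u<c , Z-sym zuw , only-wu-across-cb (≰⇒> d≰b))
      ...   | no w≮b  = neighbourCut-contradiction (Z-sym zuw) only-uw (boundary (≰⇒> d≰b) (w≡b w≮b))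

    module C<W<D<U (c<w : toℕ c < toℕ w) (w<d : toℕ w < toℕ d) (d<u : toℕ d < toℕ u) where
      a<d : toℕ a < toℕ d
      a<d = ≤-<-trans a≤w w<d
      d<b : toℕ d < toℕ b
      d<b = <-trans d<u u<b

      only-wu-across-ad : toℕ c < toℕ a → CrossedOnlyBy S a d w u
      only-wu-across-ad c<a = CrossedOnlyBy-intro only
        where
        only : ∀ x z → LinkAdj S x z → Inside a d x → Outside a d z → SamePair x z w u
        only x z l ix@(_ , x<d) (inj₁ z<a) =
          ⊥-elim (¬crosses-ab l (Inside-mono ≤-refl (<⇒≤ d<b) ix) (inj₁ z<a) (toℕ<⇒≢ (<-trans x<d d<u)))
        only x z l (a<x , x<d) (inj₂ d<z) = SamePair-swapʳ (only-uw x z l (inj₁ ((<-trans c<a a<x , x<d) , inj₂ d<z)))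

      boundary : toℕ c < toℕ a → toℕ w ≡ toℕ a → NeighbourCut c d w
      boundary c<a w≡a = middleCut (trans c+1≡a (sym w≡a)) (trans (cong suc w≡a) a+1≡d)
        where
        a+1≡d : suc (toℕ a) ≡ toℕ d
        a+1≡d = Uncrossed⇒adjacent a<d (inj₂ (≤-<-trans d<u (toℕ<n u)))
                  (CrossedOnlyBy⇒Uncrossed (only-wu-across-ad c<a) (λ (a<w , _) → <-irrefl (sym w≡a) a<w) (inj₂ d<u))
        ¬crosses-cd-before-a : ∀ {x z} → LinkAdj S x z → toℕ c < toℕ x → toℕ x < toℕ a → Outside c d z → ⊥
        ¬crosses-cd-before-a l c<x x<a oz = ¬crosses-cd l (c<x , <-trans x<a a<d) oz
          (toℕ<⇒≢ (<-trans x<a a<u)) (toℕ<⇒≢ (subst (_ <_) (sym w≡a) x<a))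
        ca-uncrossed : Uncrossed c a
        ca-uncrossed x z l (c<x , x<a) (inj₁ z<c) = ¬crosses-cd-before-a l c<x x<a (inj₁ z<c)
        ca-uncrossed x z l (c<x , x<a) (inj₂ a<z) with z Finₚ.≟ d
        ... | yes refl = ¬crosses-ab (LinkAdj-sym l) (a<d , d<b) (inj₁ x<a) (toℕ<⇒≢ d<u)
        ... | no z≢d   = ¬crosses-cd-before-a l c<x x<a
                           (inj₂ (≤∧≢⇒< (subst (_≤ toℕ z) a+1≡d a<z) (z≢d ∘ sym ∘ toℕ-injective)))
        c+1≡a : suc (toℕ c) ≡ toℕ a
        c+1≡a = Uncrossed⇒adjacent c<a (inj₂ (≤-<-trans a<u (toℕ<n u))) ca-uncrossed

      impossible : ⊥
      impossible with toℕ a ≤? toℕ c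
      ... | yes a≤c = narrower (a≤c , <⇒≤ d<b , inj₂ d<b)
                        ((c<w , w<d) , inj₂ d<u , Z-sym zuw , CrossedOnlyBy-swap only-uw)
      ... | no a≰c with toℕ a <? toℕ w
      ...   | yes a<w = narrower (≤-refl , <⇒≤ d<b , inj₂ d<b)
                          ((a<w , w<d) , inj₂ d<u , Z-sym zuw , only-wu-across-ad (≰⇒> a≰c))
      ...   | no a≮w  = neighbourCut-contradiction (Z-sym zuw) only-uw (boundary (≰⇒> a≰c) (w≡a a≮w))

  no-witness-step : ∀ {a b u v} → (∀ {a′ b′ u′ v′} → NarrowerThan a′ b′ a b → ¬ Witness a′ b′ u′ v′) →
                    ¬ Witness a b u v
  no-witness-step {a} {b} {u} {v} narrower (iu , ov , zuv , only-uv)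
    with w , zuw , w≢v ← Z-branch zuv
    with c , d , _ , crosses-cd , only-uw ← privateCut (Z⇒LinkAdj zuw)
    = by-position crosses-cd
    where
    w≢u : w ≢ u
    w≢u = proj₁ (chord (Z⇒LinkAdj zuw)) ∘ sym
    ¬outside : ¬ Outside a b w
    ¬outside ow with only-uv u w (Z⇒LinkAdj zuw) (inj₁ (iu , ow))
    ... | inj₁ (_ , w≡v) = w≢v w≡v
    ... | inj₂ (u≡v , _) = Inside-Outside-≢ iu ov u≡v
    open Step narrower iu ov only-uv zuw w≢v w≢u (≮⇒≥ (¬outside ∘ inj₁)) (≮⇒≥ (¬outside ∘ inj₂)) only-uw
    by-position : Crosses c d u w → ⊥
    by-position (inj₁ ((c<u , u<d) , inj₁ w<c)) = W<C<U<D.impossible c<u u<d w<c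
    by-position (inj₁ ((c<u , u<d) , inj₂ d<w)) = C<U<D<W.impossible c<u u<d d<w
    by-position (inj₂ (inj₁ u<c , (c<w , w<d))) = U<C<W<D.impossible u<c c<w w<d
    by-position (inj₂ (inj₂ d<u , (c<w , w<d))) = C<W<D<U.impossible c<w w<d d<u

  width-decreases : ∀ {a′ b′ a b m} → NarrowerThan a′ b′ a b → toℕ b ≤ toℕ a + suc m → toℕ b′ ≤ toℕ a′ + m
  width-decreases {a = a} {m = m} (_ , b′≤b , inj₁ a<a′) b≤a+m+1 =
    ≤-trans b′≤b (≤-trans b≤a+m+1 (≤-trans (≤-reflexive (+-suc (toℕ a) m)) (+-monoˡ-≤ m a<a′)))
  width-decreases {a = a} {m = m} (a≤a′ , _ , inj₂ b′<b) b≤a+m+1 =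
    ≤-trans (≤-pred (≤-trans b′<b (≤-trans b≤a+m+1 (≤-reflexive (+-suc (toℕ a) m))))) (+-monoˡ-≤ m a≤a′)

  no-witness : ∀ m {a b u v} → toℕ b ≤ toℕ a + m → ¬ Witness a b u v
  no-witness zero    b≤a+0 ((a<u , u<b) , _) = <-irrefl refl (<-≤-trans (<-trans a<u u<b) (subst (_ ≤_) (+-identityʳ _) b≤a+0))
  no-witness (suc m) b≤a+m+1 witness =
    no-witness-step (λ narrower → no-witness m (width-decreases narrower b≤a+m+1)) witness

  Z-empty : ∀ {u v} → ¬ Z u v
  Z-empty zuv with privateCut (Z⇒LinkAdj zuv)
  ... | _ , q , _ , inj₁ (iu , ov) , only = no-witness (toℕ q) (m≤n+m _ _) (iu , ov , zuv , only)
  ... | _ , q , _ , inj₂ (ou , iv) , only = no-witness (toℕ q) (m≤n+m _ _) (iv , ou , Z-sym zuv , CrossedOnlyBy-swap only)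

-- A cycle is a subgraph of minimum degree two

module _ {A : Set} where

  data Consecutive : List A → A → A → Set where
    here  : ∀ {x y xs} → Consecutive (x ∷ y ∷ xs) x y
    there : ∀ {x y z xs} → Consecutive xs x y → Consecutive (z ∷ xs) x y

  data Consecutive₃ : List A → A → A → A → Set where
    here  : ∀ {x y z xs} → Consecutive₃ (x ∷ y ∷ z ∷ xs) x y z
    there : ∀ {w x y z xs} → Consecutive₃ xs x y z → Consecutive₃ (w ∷ xs) x y z

  Linked⇒Consecutive : ∀ {R : A → A → Set} {xs x y} → Linked R xs → Consecutive xs x y → R x y
  Linked⇒Consecutive (r ∷ _)  here      = r
  Linked⇒Consecutive (_ ∷ rs) (there c) = Linked⇒Consecutive rs c
  Linked⇒Consecutive [-]      (there ())

  Consecutive₃⇒Consecutiveˡ : ∀ {xs x y z} → Consecutive₃ xs x y z → Consecutive xs x y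
  Consecutive₃⇒Consecutiveˡ here      = here
  Consecutive₃⇒Consecutiveˡ (there c) = there (Consecutive₃⇒Consecutiveˡ c)

  Consecutive₃⇒Consecutiveʳ : ∀ {xs x y z} → Consecutive₃ xs x y z → Consecutive xs y z
  Consecutive₃⇒Consecutiveʳ here      = there here
  Consecutive₃⇒Consecutiveʳ (there c) = there (Consecutive₃⇒Consecutiveʳ c)

  predecessor : ∀ {xs y z} → Consecutive xs y z → (∃ λ ws → xs ≡ y ∷ z ∷ ws) ⊎ (∃ λ x → Consecutive₃ xs x y z)
  predecessor here              = inj₁ (_ , refl)
  predecessor (there {z = w} c) with predecessor c
  ... | inj₁ (_ , refl) = inj₂ (w , here)
  ... | inj₂ (x , c₃)   = inj₂ (x , there c₃)

  successor : ∀ {xs x y} → Consecutive xs x y → (∃ λ ws → xs ≡ ws ++ x ∷ y ∷ []) ⊎ (∃ λ z → Consecutive₃ xs x y z)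
  successor (here {xs = []})     = inj₁ ([] , refl)
  successor (here {xs = z ∷ _})  = inj₂ (z , here)
  successor (there {z = w} c) with successor c
  ... | inj₁ (ws , refl) = inj₁ (w ∷ ws , refl)
  ... | inj₂ (z , c₃)    = inj₂ (z , there c₃)

  Unique⇒Consecutive₃-≢ : ∀ {xs x y z} → Unique xs → Consecutive₃ xs x y z → x ≢ z
  Unique⇒Consecutive₃-≢ ((_ All.∷ x≢z All.∷ _) ∷ _) here      = x≢z
  Unique⇒Consecutive₃-≢ (_ ∷ unique)                (there c) = Unique⇒Consecutive₃-≢ unique c

  Unique-rotate : ∀ {v : A} {ws} → Unique (v ∷ ws) → Unique (ws ++ [ v ])
  Unique-rotate (v∉ws ∷ unique) = Uniqueₚ.++⁺ unique (All.[] ∷ []) λ { (x∈ws , here x≡v) → All.lookup v∉ws x∈ws (sym x≡v) }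

  last-pair : ∀ {v} (z : A) (ws : List A) → ∃ λ y → Consecutive (z ∷ ws ++ [ v ]) y v × y ∈ z ∷ ws
  last-pair z []        = z , here , here refl
  last-pair z (z′ ∷ ws) with y , c , y∈ ← last-pair z′ ws = y , there c , there y∈

  last∈drop₂ : ∀ {w a b c t} (ws : List A) → ws ++ [ w ] ≡ a ∷ b ∷ c ∷ t → w ∈ c ∷ t
  last∈drop₂ {w} (_ ∷ _ ∷ ws) eq =
    subst (w ∈_) (proj₂ (∷-injective (proj₂ (∷-injective eq)))) (∈-++⁺ʳ ws (here refl))
  last∈drop₂ [] ()
  last∈drop₂ (_ ∷ []) ()

module CycleSubgraph {n : ℕ} {S : LinkSet n} {v p₁ p₂ : Fin n} {rest : List (Fin n)}
                     (unique : Unique (v ∷ p₁ ∷ p₂ ∷ rest))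
                     (linked : Linked (LinkAdj S) (v ∷ (p₁ ∷ p₂ ∷ rest) ++ [ v ])) where

  closed : List (Fin n)
  closed = v ∷ (p₁ ∷ p₂ ∷ rest) ++ [ v ]

  OnCycle : Fin n → Fin n → Set
  OnCycle x y = Consecutive closed x y ⊎ Consecutive closed y x

  OnCycle-sym : ∀ {x y} → OnCycle x y → OnCycle y x
  OnCycle-sym (inj₁ c) = inj₂ c
  OnCycle-sym (inj₂ c) = inj₁ c

  OnCycle⇒LinkAdj : ∀ {x y} → OnCycle x y → LinkAdj S x y
  OnCycle⇒LinkAdj (inj₁ c) = Linked⇒Consecutive linked c
  OnCycle⇒LinkAdj (inj₂ c) = LinkAdj-sym (Linked⇒Consecutive linked c)

  neighbours-≢ : ∀ {x y z} → Consecutive₃ closed x y z → x ≢ z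
  neighbours-≢ here      = All.lookup (AllPairs.head unique) (there (here refl))
  neighbours-≢ (there c) = Unique⇒Consecutive₃-≢ (Unique-rotate unique) c

  ≢p₁ : ∀ {y} → y ∈ p₂ ∷ rest → y ≢ p₁
  ≢p₁ y∈ y≡p₁ = All.lookup (AllPairs.head (AllPairs.tail unique)) y∈ (sym y≡p₁)

  OnCycle-branch : ∀ {u w} → OnCycle u w → ∃ λ w′ → OnCycle u w′ × w′ ≢ w
  OnCycle-branch (inj₁ c) with predecessor c
  ... | inj₁ (_ , refl) with y , c′ , y∈ ← last-pair p₂ rest = y , inj₂ (there (there c′)) , ≢p₁ y∈
  ... | inj₂ (x , c₃)   = x , inj₂ (Consecutive₃⇒Consecutiveˡ c₃) , neighbours-≢ c₃
  OnCycle-branch {u} {w} (inj₂ c) with successor c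
  ... | inj₂ (y , c₃)   = y , inj₁ (Consecutive₃⇒Consecutiveʳ c₃) , λ y≡w → neighbours-≢ c₃ (sym y≡w)
  ... | inj₁ (ws , eq)  with ws++w≡ , u≡v ← ∷ʳ-injective (ws ++ [ w ]) (v ∷ p₁ ∷ p₂ ∷ rest)
                                             (trans (++-assoc ws [ w ] [ u ]) (sym eq))
    = p₁ , inj₁ (subst (λ x → Consecutive closed x p₁) (sym u≡v) here) ,
      λ p₁≡w → ≢p₁ (last∈drop₂ ws ws++w≡) (sym p₁≡w)

-- A forest on n vertices has at most n - 1 edges

fixedPoints : (Fin n → Fin n) → List (Fin n) → ℕ
fixedPoints f []       = 0
fixedPoints f (x ∷ xs) with f x Finₚ.≟ x
... | yes _ = suc (fixedPoints f xs)
... | no  _ = fixedPoints f xs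

fixedPoints-id : (xs : List (Fin n)) → fixedPoints (λ x → x) xs ≡ length xs
fixedPoints-id []       = refl
fixedPoints-id (x ∷ xs) with x Finₚ.≟ x
... | yes _  = cong suc (fixedPoints-id xs)
... | no x≢x = ⊥-elim (x≢x refl)

fixedPoints-pos : x ∈ xs → f x ≡ x → 0 < fixedPoints f xs
fixedPoints-pos {xs = y ∷ xs} {f = f} x∈ fx≡x with f y Finₚ.≟ y | x∈
... | yes _   | _         = s≤s z≤n
... | no fy≢y | here refl = ⊥-elim (fy≢y fx≡x)
... | no _    | there x∈xs = fixedPoints-pos x∈xs fx≡x

SameFixedPoint : (Fin n → Fin n) → (Fin n → Fin n) → Fin n → Set
SameFixedPoint f g x = f x ≡ x ⇔ g x ≡ x

fixedPoints-cong : (xs : List (Fin n)) → (∀ {x} → x ∈ xs → SameFixedPoint f g x) →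
                   fixedPoints f xs ≡ fixedPoints g xs
fixedPoints-cong []       _    = refl
fixedPoints-cong {f = f} {g} (x ∷ xs) same with f x Finₚ.≟ x | g x Finₚ.≟ x
... | yes _    | yes _    = cong suc (fixedPoints-cong xs (λ x∈ → same (there x∈)))
... | yes fx≡x | no gx≢x  = ⊥-elim (gx≢x (Equivalence.to (same (here refl)) fx≡x))
... | no fx≢x  | yes gx≡x = ⊥-elim (fx≢x (Equivalence.from (same (here refl)) gx≡x))
... | no _     | no _     = fixedPoints-cong xs (λ x∈ → same (there x∈))

fixedPoints-remove : (xs : List (Fin n)) → Unique xs → k ∈ xs → f k ≡ k → g k ≢ k →
                     (∀ {x} → x ∈ xs → x ≢ k → SameFixedPoint f g x) →
                     fixedPoints f xs ≡ suc (fixedPoints g xs)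
fixedPoints-remove {f = f} {g = g} (x ∷ xs) (x∉xs ∷ unique) k∈ fk≡k gk≢k same
  with f x Finₚ.≟ x | g x Finₚ.≟ x | k∈
... | _        | yes gx≡x | here refl  = ⊥-elim (gk≢k gx≡x)
... | no fx≢x  | _        | here refl  = ⊥-elim (fx≢x fk≡k)
... | yes _    | no _     | here refl  =
  cong suc (fixedPoints-cong xs (λ y∈ → same (there y∈) (λ { refl → All.lookup x∉xs y∈ refl })))
... | yes _    | yes _    | there k∈xs = cong suc (fixedPoints-remove xs unique k∈xs fk≡k gk≢k (λ y∈ → same (there y∈)))
... | yes fx≡x | no gx≢x  | there k∈xs =
  ⊥-elim (gx≢x (Equivalence.to (same (here refl) (λ { refl → All.lookup x∉xs k∈xs refl })) fx≡x))
... | no fx≢x  | yes gx≡x | there k∈xs =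
  ⊥-elim (fx≢x (Equivalence.from (same (here refl) (λ { refl → All.lookup x∉xs k∈xs refl })) gx≡x))
... | no _     | no _     | there k∈xs = fixedPoints-remove xs unique k∈xs fk≡k gk≢k (λ y∈ → same (there y∈))

data Path (R : Fin n → Fin n → Set) : Fin n → Fin n → List (Fin n) → Set where
  ε   : Path R x x []
  _◅_ : R x y → Path R y z ws → Path R x z (y ∷ ws)

Path-map : (∀ {a b} → R a b → R′ a b) → Path R x y ws → Path R′ x y ws
Path-map f ε       = ε
Path-map f (r ◅ p) = f r ◅ Path-map f p

Path-join : Path R x a ws₁ → R a b → Path R b y ws₂ → Path R x y (ws₁ ++ b ∷ ws₂)
Path-join ε        r q = r ◅ q
Path-join (r′ ◅ p) r q = r′ ◅ Path-join p r q

Path-close : Path R x y ws → R y z → Linked R (x ∷ ws ++ [ z ])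
Path-close ε       r = r ∷ [-]
Path-close (r ◅ p) r′ = r ∷ Path-close p r′

LinkAdj-∷ : ∀ {e} {E : LinkSet n} → LinkAdj E x y → LinkAdj (e ∷ E) x y
LinkAdj-∷ (inj₁ xy∈E) = inj₁ (there xy∈E)
LinkAdj-∷ (inj₂ yx∈E) = inj₂ (there yx∈E)

LinkAdj-⊆ : {E F : LinkSet n} → E ⊆ F → LinkAdj E x y → LinkAdj F x y
LinkAdj-⊆ E⊆F (inj₁ xy∈E) = inj₁ (E⊆F xy∈E)
LinkAdj-⊆ E⊆F (inj₂ yx∈E) = inj₂ (E⊆F yx∈E)

-- Adding the links of an acyclic S one at a time, each merges two components.
module Forest {n : ℕ} {S : LinkSet n} (acyclic : Acyclic S) where

  record LabelledPath (E : LinkSet n) (label : Fin n → Fin n) (x y : Fin n) : Set where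
    field
      vertices   : List (Fin n)
      path       : Path (LinkAdj E) x y vertices
      unique     : Unique (x ∷ vertices)
      same-label : All.All (λ z → label z ≡ label x) (x ∷ vertices)

  -- label picks a representative of each component, so its fixed points count the components.
  record Components (E : LinkSet n) : Set where
    field
      label      : Fin n → Fin n
      label-idem : ∀ x → label (label x) ≡ label x
      connect    : ∀ x y → label x ≡ label y → LabelledPath E label x y
      count      : length E + fixedPoints label (allFin n) ≡ n

  components-[] : Components []
  components-[] = record
    { label      = λ x → x
    ; label-idem = λ _ → refl
    ; connect    = λ { x .x refl → record { vertices = [] ; path = ε ; unique = All.[] ∷ [] ; same-label = refl All.∷ All.[] } }
    ; count      = trans (fixedPoints-id (allFin n)) (length-tabulate (λ x → x))
    }

  ends-disconnected : ∀ {E label} → WellFormed ((i , j) ∷ E) → (i , j) ∷ E ⊆ S → ¬ LabelledPath E label i j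
  ends-disconnected (_ , chord) _ record { vertices = [] ; path = ε } = <-irrefl refl (proj₁ (chord (here refl)))
  ends-disconnected (ij∉E ∷ _ , _) _ record { vertices = _ ∷ [] ; path = inj₁ ij∈E ◅ ε } = All.lookup ij∉E ij∈E refl
  ends-disconnected (_ , chord) _ record { vertices = _ ∷ [] ; path = inj₂ ji∈E ◅ ε } =
    <-asym (proj₁ (chord (here refl))) (proj₁ (chord (there ji∈E)))
  ends-disconnected {i = i} _ sub record { vertices = z ∷ z′ ∷ ws ; path = p ; unique = u } =
    acyclic (i , z ∷ z′ ∷ ws , s≤s (s≤s z≤n) , u , Path-close (Path-map (LinkAdj-⊆ sub ∘ LinkAdj-∷) p) (inj₂ (sub (here refl))))

  module Merge {E : LinkSet n} (C : Components E) {i j : Fin n}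
               (i≁j : Components.label C i ≢ Components.label C j) where
    open Components C
    open LabelledPath
    open ≡-Reasoning

    relabel : Fin n → Fin n
    relabel k with k Finₚ.≟ label j
    ... | yes _ = label i
    ... | no  _ = k

    relabel-≡ : k ≡ label j → relabel k ≡ label i
    relabel-≡ {k} k≈j with k Finₚ.≟ label j
    ... | yes _   = refl
    ... | no k≁j  = ⊥-elim (k≁j k≈j)

    relabel-≢ : k ≢ label j → relabel k ≡ k
    relabel-≢ {k} k≁j with k Finₚ.≟ label j
    ... | yes k≈j = ⊥-elim (k≁j k≈j)
    ... | no _    = refl

    label′ : Fin n → Fin n
    label′ x = relabel (label x)

    label′-idem : ∀ x → label′ (label′ x) ≡ label′ x
    label′-idem x = by-cases (label x Finₚ.≟ label j)
      where
      by-cases : Dec (label x ≡ label j) → label′ (label′ x) ≡ label′ x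
      by-cases (yes x≈j) = begin
        relabel (label (relabel (label x))) ≡⟨ cong (relabel ∘ label) (relabel-≡ x≈j) ⟩
        relabel (label (label i))           ≡⟨ cong relabel (label-idem i) ⟩
        relabel (label i)                   ≡⟨ relabel-≢ i≁j ⟩
        label i                             ≡⟨ sym (relabel-≡ x≈j) ⟩
        relabel (label x)                   ∎
      by-cases (no x≁j) = begin
        relabel (label (relabel (label x))) ≡⟨ cong (relabel ∘ label) (relabel-≢ x≁j) ⟩
        relabel (label (label x))           ≡⟨ cong relabel (label-idem x) ⟩
        relabel (label x)                   ∎

    lift : LabelledPath E label x y → LabelledPath ((i , j) ∷ E) label′ x y
    lift P = record
      { vertices   = vertices P
      ; path       = Path-map LinkAdj-∷ (path P)
      ; unique     = unique P
      ; same-label = All.map (cong relabel) (same-label P)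
      }

    -- The two pieces lie in the old components of x and b, hence are disjoint.
    join : LabelledPath E label x a → LinkAdj ((i , j) ∷ E) a b → LabelledPath E label b y →
           label x ≢ label b → label′ x ≡ label′ b → LabelledPath ((i , j) ∷ E) label′ x y
    join P₁ a-b P₂ x≁b x≈′b = record
      { vertices   = vertices P₁ ++ _ ∷ vertices P₂
      ; path       = Path-join (Path-map LinkAdj-∷ (path P₁)) a-b (Path-map LinkAdj-∷ (path P₂))
      ; unique     = Uniqueₚ.++⁺ (unique P₁) (unique P₂) disjoint
      ; same-label = Allₚ.++⁺ (All.map (cong relabel) (same-label P₁))
                             (All.map (λ z≈b → trans (cong relabel z≈b) (sym x≈′b)) (same-label P₂))
      }
      where
      disjoint : ∀ {z} → ¬ (z ∈ _ ∷ vertices P₁ × z ∈ _ ∷ vertices P₂)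
      disjoint (z∈₁ , z∈₂) = x≁b (trans (sym (All.lookup (same-label P₁) z∈₁)) (All.lookup (same-label P₂) z∈₂))

    connect′ : ∀ x y → label′ x ≡ label′ y → LabelledPath ((i , j) ∷ E) label′ x y
    connect′ x y x≈′y = by-cases (label x Finₚ.≟ label j) (label y Finₚ.≟ label j)
      where
      by-cases : Dec (label x ≡ label j) → Dec (label y ≡ label j) → LabelledPath ((i , j) ∷ E) label′ x y
      by-cases (yes x≈j) (yes y≈j) = lift (connect x y (trans x≈j (sym y≈j)))
      by-cases (yes x≈j) (no y≁j)  =
        join (connect x j x≈j) (inj₂ (here refl))
             (connect i y (trans (sym (relabel-≡ x≈j)) (trans x≈′y (relabel-≢ y≁j))))
             (λ x≈i → i≁j (trans (sym x≈i) x≈j)) (trans (relabel-≡ x≈j) (sym (relabel-≢ i≁j)))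
      by-cases (no x≁j)  (yes y≈j) =
        join (connect x i (trans (sym (relabel-≢ x≁j)) (trans x≈′y (relabel-≡ y≈j)))) (inj₁ (here refl))
             (connect j y (sym y≈j)) x≁j (trans x≈′y (cong relabel y≈j))
      by-cases (no x≁j)  (no y≁j)  = lift (connect x y (trans (sym (relabel-≢ x≁j)) (trans x≈′y (relabel-≢ y≁j))))

    -- Exactly the representative label j stops being a fixed point.
    same-fixed-points : ∀ {x} → x ∈ allFin n → x ≢ label j → SameFixedPoint label label′ x
    same-fixed-points {x} _ x≢j = mk⇔ (λ x≈x → trans (cong relabel x≈x) (relabel-≢ x≢j)) from
      where
      from : label′ x ≡ x → label x ≡ x
      from x≈′x = by-cases (label x Finₚ.≟ label j)
        where
        by-cases : Dec (label x ≡ label j) → label x ≡ x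
        by-cases (yes x≈j) = ⊥-elim (i≁j (begin
          label i         ≡⟨ sym (label-idem i) ⟩
          label (label i) ≡⟨ cong label (trans (sym (relabel-≡ x≈j)) x≈′x) ⟩
          label x         ≡⟨ x≈j ⟩
          label j         ∎))
        by-cases (no x≁j) = trans (sym (relabel-≢ x≁j)) x≈′x

    count′ : length ((i , j) ∷ E) + fixedPoints label′ (allFin n) ≡ n
    count′ = begin
      suc (length E) + fixedPoints label′ (allFin n)   ≡⟨ sym (+-suc (length E) _) ⟩
      length E + suc (fixedPoints label′ (allFin n))   ≡⟨ cong (length E +_) (sym (fixedPoints-remove (allFin n)
                                                           (Uniqueₚ.allFin⁺ n) (∈-allFin (label j)) (label-idem j)
                                                           j-moved same-fixed-points)) ⟩
      length E + fixedPoints label (allFin n)          ≡⟨ count ⟩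
      n                                                ∎
      where
      j-moved : label′ (label j) ≢ label j
      j-moved j≈′j = i≁j (trans (sym (relabel-≡ refl)) (trans (cong relabel (sym (label-idem j))) j≈′j))

    merged : Components ((i , j) ∷ E)
    merged = record { label = label′ ; label-idem = label′-idem ; connect = connect′ ; count = count′ }

  components : (E : LinkSet n) → WellFormed E → E ⊆ S → Components E
  components []            _                      _   = components-[]
  components ((i , j) ∷ E) wf@(_ ∷ unique , chord) sub with components E (unique , chord ∘ there) (sub ∘ there)
  ... | C with Components.label C i Finₚ.≟ Components.label C j
  ...   | yes i≈j = ⊥-elim (ends-disconnected wf sub (Components.connect C i j i≈j))
  ...   | no i≁j  = Merge.merged C i≁j

  length≤n∸1 : WellFormed S → 0 < n → length S ≤ n ∸ 1
  length≤n∸1 wf 0<n = m+n≤o⇒m≤o∸n (length S) (begin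
    length S + 1                               ≤⟨ +-monoʳ-≤ (length S) (fixedPoints-pos (∈-allFin (label v₀)) (label-idem v₀)) ⟩
    length S + fixedPoints label (allFin n)    ≡⟨ count ⟩
    n                                          ∎)
    where
    open Components (components S wf (λ e∈S → e∈S))
    open ≤-Reasoning
    v₀ : Fin n
    v₀ = fromℕ< 0<n

LinkAdj⇒chord : WellFormed S → LinkAdj S u w → u ≢ w × ¬ CycEdge u w
LinkAdj⇒chord (_ , chord) (inj₁ uw∈S) = toℕ<⇒≢ (proj₁ (chord uw∈S)) , proj₂ (chord uw∈S)
LinkAdj⇒chord (_ , chord) (inj₂ wu∈S) = toℕ>⇒≢ (proj₁ (chord wu∈S)) , proj₂ (chord wu∈S) ∘ CycEdge-sym

minimal⇒acyclic : {S : LinkSet n} → 3 < n → WellFormed S → Feasible S →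
                  (∀ T → T ⊆ S → Feasible T → S ⊆ T) → Acyclic S
minimal⇒acyclic 3<n wf feasible minimal (_ , []         , ()      , _)
minimal⇒acyclic 3<n wf feasible minimal (_ , _ ∷ []     , s≤s () , _)
minimal⇒acyclic {S = S} 3<n wf feasible minimal (_ , _ ∷ _ ∷ _ , _ , unique , linked) =
  Descent.Z-empty (ThreeConnected⇒CrossesAllCuts feasible) private-cut (LinkAdj⇒chord wf)
                  OnCycle OnCycle-sym OnCycle⇒LinkAdj OnCycle-branch (inj₁ here)
  where
  open CycleSubgraph unique linked
  private-cut : ∀ {u w} → LinkAdj S u w → PrivateCut S u w
  private-cut (inj₁ uw∈S) = privateCut 3<n feasible minimal uw∈S
  private-cut (inj₂ wu∈S) = PrivateCut-sym (privateCut 3<n feasible minimal wu∈S)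

lemma2 : (n : ℕ) → 4 ≤ n → (S S' : LinkSet n) → Instance S → MinimalFeasible S S' →
    Acyclic S' × length S' ≤ n ∸ 1 ×
    (∀ (O : LinkSet n) → Optimum S O → length S' ≤ 2 * length O)
lemma2 n 3<n S S' _ (wf , _ , feasible , minimal) = acyclic , length≤n∸1 , length≤2*OPT
  where
  acyclic : Acyclic S'
  acyclic = minimal⇒acyclic 3<n wf feasible minimal
  length≤n∸1 : length S' ≤ n ∸ 1
  length≤n∸1 = Forest.length≤n∸1 acyclic wf (<-trans (s≤s z≤n) 3<n)
  length≤2*OPT : ∀ O → Optimum S O → length S' ≤ 2 * length O
  length≤2*OPT O (_ , _ , feasibleO , _) =
    ≤-trans length≤n∸1 (≤-trans (m∸n≤m n 1) (n≤2*length 3<n (ThreeConnected⇒CrossesAllCuts feasibleO)))
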